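{- Let $q$ and $x$ be indeterminates, $[n]=\frac{1-q^n}{1-q}$, $[n]!=[1]\cdots[n]$ (with $[0]!=1$), and $(x;q)_n=\prod_{j=0}^{n-1}(1-q^jx)$. Then for every $n\ge1$, $$\det\left((x;q)_{i+j}\right)_{i,j=0}^{n-1}=q^{2\binom{n}{3}}(1-q)^{\binom{n}{2}}x^{\binom{n}{2}}\prod_{j=0}^{n-1}[j]!\,(x;q)_j$$ and $$\det\left((x;q)_{i+j+1}\right)_{i,j=0}^{n-1}=q^{2\binom{n}{3}+\binom{n}{2}}(1-q)^{\binom{n}{2}}x^{\binom{n}{2}}\prod_{j=0}^{n-1}[j]!\,(x;q)_{j+1}.$$ -}

module Defs where

open import Level using (Level)
open import Algebra.Bundles using (CommutativeRing)
open import Data.Nat using (ℕ; zero; suc)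
open import Data.Fin using (Fin; zero; suc; toℕ; punchIn)

module _ {c ℓ : Level} (R : CommutativeRing c ℓ) where
  open CommutativeRing R using (Carrier; _+_; _*_; -_; _-_; 0#; 1#)

  pow : Carrier → ℕ → Carrier
  pow r zero    = 1#
  pow r (suc k) = r * pow r k

  sumFin : (n : ℕ) → (Fin n → Carrier) → Carrier
  sumFin zero    f = 0#
  sumFin (suc n) f = f zero + sumFin n (λ i → f (suc i))

  prodFin : (n : ℕ) → (Fin n → Carrier) → Carrier
  prodFin zero    f = 1#
  prodFin (suc n) f = f zero * prodFin n (λ i → f (suc i))

  prodN : ℕ → (ℕ → Carrier) → Carrier
  prodN n f = prodFin n (λ j → f (toℕ j))

  det : (n : ℕ) → (Fin n → Fin n → Carrier) → Carrier
  det zero    M = 1#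
  det (suc n) M =
    sumFin (suc n) (λ j →
      pow (- 1#) (toℕ j) * (M zero j * det n (λ a b → M (suc a) (punchIn j b))))

  -- q-integer [n] = 1 + q + ... + q^(n-1) = (1 - q^n)/(1 - q)
  qint : Carrier → ℕ → Carrier
  qint q n = sumFin n (λ i → pow q (toℕ i))

  qfact : Carrier → ℕ → Carrier
  qfact q n = prodN n (λ i → qint q (suc i))

  poch : Carrier → Carrier → ℕ → Carrier
  poch x q n = prodN n (λ j → 1# - pow q j * x)

-- Subtracting (1 - q^i x) times row i from row i+1 of the Hankel matrix of (x;q)_k, using
-- (x;q)_{i+m+1} - (1 - q^i x) (x;q)_{i+m} = x q^i (1 - q^m) (x;q)_{i+m}, clears the first column below
-- the corner entry 1 and leaves the matrix of the shifted sequence (x;q)_{k+1} with row i scaled by x q^i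
-- and column j by 1 - q^{j+1}.  Since (x;q)_{k+1} = (1 - x) (qx;q)_k, that Hankel determinant is in turn
-- (1 - x)^n times the unshifted one at qx.  The two recurrences determine both determinants from the
-- empty one, and the closed forms satisfy the same recurrences.
module Submission where

open import Defs
open import Algebra.Bundles using (CommutativeRing)
open import Data.Fin using (Fin; zero; suc; toℕ; punchIn; inject₁)
open import Data.Fin.Properties using (toℕ-inject₁)
open import Data.Nat as ℕ using (ℕ; zero; suc)
import Data.Nat.Properties as ℕₚ
open import Data.Nat.Combinatorics using (_C_; nCk+nC[k+1]≡[n+1]C[k+1]; nC1≡n)
open import Data.Nat.Tactic.RingSolver using (solve-∀)
open import Data.Product using (_×_; _,_)
open import Data.Vec.Functional using (_∷_; tail)
import Relation.Binary.PropositionalEquality as ≡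

[1+n]C2≡n+nC2 : ∀ n → suc n C 2 ≡.≡ n ℕ.+ n C 2
[1+n]C2≡n+nC2 n =
  ≡.trans (≡.sym (nCk+nC[k+1]≡[n+1]C[k+1] n 1)) (≡.cong (ℕ._+ n C 2) (nC1≡n n))

2*[1+n]C3≡nC2+[2*nC3+nC2] : ∀ n → 2 ℕ.* (suc n C 3) ≡.≡ n C 2 ℕ.+ (2 ℕ.* (n C 3) ℕ.+ n C 2)
2*[1+n]C3≡nC2+[2*nC3+nC2] n =
  ≡.trans (≡.cong (2 ℕ.*_) (≡.sym (nCk+nC[k+1]≡[n+1]C[k+1] n 2))) (double (n C 2) (n C 3))
  where
  double : ∀ a b → 2 ℕ.* (a ℕ.+ b) ≡.≡ a ℕ.+ (2 ℕ.* b ℕ.+ a)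
  double = solve-∀

module _ {c ℓ} (R : CommutativeRing c ℓ) where
  open CommutativeRing R hiding (zero)
  open import Algebra.Properties.Ring ring using (-1*x≈-x; -‿involutive; -0#≈0#; -‿+-comm)
  open import Algebra.Solver.Ring.NaturalCoefficients.Default commutativeSemiring
  open import Relation.Binary.Reasoning.Setoid setoid

  -- The semiring solver knows no negation, so -1 enters its identities as a variable.
  -1# : Carrier
  -1# = - 1#

  x-y≈x+-1*y : ∀ x y → x - y ≈ x + -1# * y
  x-y≈x+-1*y x y = +-congˡ (sym (-1*x≈-x y))

  -1*-1≈1 : -1# * -1# ≈ 1#
  -1*-1≈1 = trans (-1*x≈-x -1#) (-‿involutive 1#)

  1+-1≈0 : 1# + -1# ≈ 0#
  1+-1≈0 = -‿inverseʳ 1#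

  pow-homo-* : ∀ a i j → pow R a (i ℕ.+ j) ≈ pow R a i * pow R a j
  pow-homo-* a zero    j = sym (*-identityˡ _)
  pow-homo-* a (suc i) j = trans (*-congˡ (pow-homo-* a i j)) (sym (*-assoc _ _ _))

  pow-split : ∀ a i j {k} → k ≡.≡ i ℕ.+ j → pow R a k ≈ pow R a i * pow R a j
  pow-split a i j k≡i+j = trans (reflexive (≡.cong (pow R a) k≡i+j)) (pow-homo-* a i j)

  pow-distrib-* : ∀ a b i → pow R (a * b) i ≈ pow R a i * pow R b i
  pow-distrib-* a b zero    = sym (*-identityˡ 1#)
  pow-distrib-* a b (suc i) = trans (*-congˡ (pow-distrib-* a b i))
    (solve 4 (λ a b u v → (a :* b) :* (u :* v) := (a :* u) :* (b :* v)) refl a b (pow R a i) (pow R b i))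

  sumFin-cong : ∀ n {f g : Fin n → Carrier} → (∀ i → f i ≈ g i) → sumFin R n f ≈ sumFin R n g
  sumFin-cong zero    f≈g = refl
  sumFin-cong (suc n) f≈g = +-cong (f≈g zero) (sumFin-cong n (λ i → f≈g (suc i)))

  sumFin-zero : ∀ n {f : Fin n → Carrier} → (∀ i → f i ≈ 0#) → sumFin R n f ≈ 0#
  sumFin-zero zero    f≈0 = refl
  sumFin-zero (suc n) f≈0 = trans (+-cong (f≈0 zero) (sumFin-zero n (λ i → f≈0 (suc i)))) (+-identityˡ 0#)

  sumFin-distrib-+ : ∀ n (f g : Fin n → Carrier) → sumFin R n (λ i → f i + g i) ≈ sumFin R n f + sumFin R n g
  sumFin-distrib-+ zero    f g = sym (+-identityˡ 0#)
  sumFin-distrib-+ (suc n) f g = trans (+-congˡ (sumFin-distrib-+ n _ _))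
    (solve 4 (λ a b u v → (a :+ b) :+ (u :+ v) := (a :+ u) :+ (b :+ v)) refl
      (f zero) (g zero) (sumFin R n (λ i → f (suc i))) (sumFin R n (λ i → g (suc i))))

  sumFin-neg : ∀ n (f : Fin n → Carrier) → sumFin R n (λ i → - f i) ≈ - sumFin R n f
  sumFin-neg zero    f = sym -0#≈0#
  sumFin-neg (suc n) f = trans (+-congˡ (sumFin-neg n _)) (-‿+-comm _ _)

  *-distribˡ-sumFin : ∀ n a (f : Fin n → Carrier) → a * sumFin R n f ≈ sumFin R n (λ i → a * f i)
  *-distribˡ-sumFin zero    a f = zeroʳ a
  *-distribˡ-sumFin (suc n) a f = trans (distribˡ a _ _) (+-congˡ (*-distribˡ-sumFin n a _))

  sumFin-linear : ∀ n a (f g : Fin n → Carrier) →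
                  sumFin R n (λ i → f i - a * g i) ≈ sumFin R n f - a * sumFin R n g
  sumFin-linear n a f g = begin
    sumFin R n (λ i → f i - a * g i)             ≈⟨ sumFin-distrib-+ n f _ ⟩
    sumFin R n f + sumFin R n (λ i → - (a * g i)) ≈⟨ +-congˡ (sumFin-neg n _) ⟩
    sumFin R n f - sumFin R n (λ i → a * g i)     ≈⟨ +-congˡ (-‿cong (*-distribˡ-sumFin n a g)) ⟨
    sumFin R n f - a * sumFin R n g               ∎

  sumFin-comm : ∀ m n (f : Fin m → Fin n → Carrier) →
                sumFin R m (λ i → sumFin R n (f i)) ≈ sumFin R n (λ j → sumFin R m (λ i → f i j))
  sumFin-comm zero    n f = sym (sumFin-zero n (λ _ → refl))
  sumFin-comm (suc m) n f = trans (+-congˡ (sumFin-comm m n _)) (sym (sumFin-distrib-+ n _ _))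

  prodN-cong : ∀ n {f g : ℕ → Carrier} → (∀ k → f k ≈ g k) → prodN R n f ≈ prodN R n g
  prodN-cong zero    f≈g = refl
  prodN-cong (suc n) f≈g = *-cong (f≈g 0) (prodN-cong n (λ k → f≈g (suc k)))

  prodN-distrib-* : ∀ n (f g : ℕ → Carrier) → prodN R n (λ k → f k * g k) ≈ prodN R n f * prodN R n g
  prodN-distrib-* zero    f g = sym (*-identityˡ 1#)
  prodN-distrib-* (suc n) f g = trans (*-congˡ (prodN-distrib-* n (λ k → f (suc k)) (λ k → g (suc k))))
    (solve 4 (λ a b u v → (a :* b) :* (u :* v) := (a :* u) :* (b :* v)) refl
      (f 0) (g 0) (prodN R n (λ k → f (suc k))) (prodN R n (λ k → g (suc k))))

  prodN-const : ∀ n a → prodN R n (λ _ → a) ≈ pow R a n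
  prodN-const zero    a = refl
  prodN-const (suc n) a = *-congˡ (prodN-const n a)

  prodN-suc : ∀ n (f : ℕ → Carrier) → prodN R (suc n) f ≈ prodN R n f * f n
  prodN-suc zero    f = *-comm (f 0) 1#
  prodN-suc (suc n) f = trans (*-congˡ (prodN-suc n (λ k → f (suc k)))) (sym (*-assoc _ _ _))

  prodN-scale : ∀ n a (f : ℕ → Carrier) → prodN R n (λ k → a * f k) ≈ pow R a n * prodN R n f
  prodN-scale n a f = trans (prodN-distrib-* n (λ _ → a) f) (*-congʳ (prodN-const n a))

  Matrix : ℕ → Set c
  Matrix n = Fin n → Fin n → Carrier

  sign : ℕ → Carrier
  sign = pow R -1#

  minor : ∀ {n} → Fin (suc n) → Fin (suc n) → Matrix (suc n) → Matrix n
  minor i j M a b = M (punchIn i a) (punchIn j b)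

  det-cong : ∀ n {M N : Matrix n} → (∀ i j → M i j ≈ N i j) → det R n M ≈ det R n N
  det-cong zero    M≈N = refl
  det-cong (suc n) M≈N = sumFin-cong (suc n) (λ j →
    *-congˡ {x = sign (toℕ j)} (*-cong (M≈N zero j) (det-cong n (λ a b → M≈N (suc a) (punchIn j b)))))

  det-expand-col0 : ∀ n (M : Matrix (suc n)) →
    det R (suc n) M ≈ sumFin R (suc n) (λ i → sign (toℕ i) * (M i zero * det R n (minor i zero M)))
  det-expand-col0 zero    M = refl
  det-expand-col0 (suc n) M = +-congˡ (begin
      sumFin R (suc n) (λ j → sign (suc (toℕ j)) * (M zero (suc j) * det R (suc n) (minor zero (suc j) M)))
    ≈⟨ sumFin-cong (suc n) (λ j → *-congˡ {x = sign (suc (toℕ j))} (*-congˡ {x = M zero (suc j)}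
         (det-expand-col0 n (minor zero (suc j) M)))) ⟩
      sumFin R (suc n) (λ j → sign (suc (toℕ j)) * (M zero (suc j) * sumFin R (suc n) (λ i → col-cofactor i j)))
    ≈⟨ sumFin-cong (suc n) (λ j → pull (sign (suc (toℕ j))) (M zero (suc j)) (λ i → col-cofactor i j)) ⟩
      sumFin R (suc n) (λ j → sumFin R (suc n) (λ i → (sign (suc (toℕ j)) * M zero (suc j)) * col-cofactor i j))
    ≈⟨ sumFin-comm (suc n) (suc n) (λ j i → (sign (suc (toℕ j)) * M zero (suc j)) * col-cofactor i j) ⟩
      sumFin R (suc n) (λ i → sumFin R (suc n) (λ j → (sign (suc (toℕ j)) * M zero (suc j)) * col-cofactor i j))
    ≈⟨ sumFin-cong (suc n) (λ i → sumFin-cong (suc n) (λ j →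
         swap (sign (toℕ j)) (sign (toℕ i)) (M zero (suc j)) (M (suc i) zero) (X i j))) ⟩
      sumFin R (suc n) (λ i → sumFin R (suc n) (λ j → (sign (suc (toℕ i)) * M (suc i) zero) * row-cofactor i j))
    ≈⟨ sumFin-cong (suc n) (λ i → pull (sign (suc (toℕ i))) (M (suc i) zero) (row-cofactor i)) ⟨
      sumFin R (suc n) (λ i → sign (suc (toℕ i)) * (M (suc i) zero * det R (suc n) (minor (suc i) zero M)))
    ∎)
    where
    X : Fin (suc n) → Fin (suc n) → Carrier
    X i j = det R n (minor i j (minor zero zero M))
    col-cofactor row-cofactor : Fin (suc n) → Fin (suc n) → Carrier
    col-cofactor i j = sign (toℕ i) * (M (suc i) zero * X i j)
    row-cofactor i j = sign (toℕ j) * (M zero (suc j) * X i j)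
    pull : ∀ s a (g : Fin (suc n) → Carrier) →
           s * (a * sumFin R (suc n) g) ≈ sumFin R (suc n) (λ i → (s * a) * g i)
    pull s a g = trans (sym (*-assoc s a _)) (*-distribˡ-sumFin (suc n) (s * a) g)
    swap : ∀ t u a b x → ((-1# * t) * a) * (u * (b * x)) ≈ ((-1# * u) * b) * (t * (a * x))
    swap t u a b x = solve 6
      (λ m t u a b x → ((m :* t) :* a) :* (u :* (b :* x)) := ((m :* u) :* b) :* (t :* (a :* x))) refl -1# t u a b x

  cofactor-vanishes : ∀ s a {d} → d ≈ 0# → s * (a * d) ≈ 0#
  cofactor-vanishes s a d≈0 = trans (*-congˡ {x = s} (trans (*-congˡ {x = a} d≈0) (zeroʳ a))) (zeroʳ s)

  -- Expanding along column 0, the cofactors of rows 0 and 1 cancel, and every other minor keeps both rows.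
  det-equal-rows01≈0 : ∀ n (M : Matrix (suc (suc n))) → (∀ j → M zero j ≈ M (suc zero) j) →
                       det R (suc (suc n)) M ≈ 0#
  lower-cofactors-vanish : ∀ n (M : Matrix (suc (suc n))) → (∀ j → M zero j ≈ M (suc zero) j) →
    sumFin R n (λ i →
      sign (toℕ (suc (suc i))) * (M (suc (suc i)) zero * det R (suc n) (minor (suc (suc i)) zero M))) ≈ 0#

  det-equal-rows01≈0 n M row0≈row1 = begin
      det R (suc (suc n)) M
    ≈⟨ det-expand-col0 (suc n) M ⟩
      1# * (M zero zero * Y) + ((-1# * 1#) * (M (suc zero) zero * Y′) + rest)
    ≈⟨ +-congˡ (+-cong (*-congˡ (*-cong (sym (row0≈row1 zero)) (det-cong (suc n) minors-agree)))
                       (lower-cofactors-vanish n M row0≈row1)) ⟩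
      1# * (M zero zero * Y) + ((-1# * 1#) * (M zero zero * Y) + 0#)
    ≈⟨ solve 2 (λ m y → con 1 :* y :+ ((m :* con 1) :* y :+ con 0) := (con 1 :+ m) :* y)
         refl -1# (M zero zero * Y) ⟩
      (1# + -1#) * (M zero zero * Y)
    ≈⟨ trans (*-congʳ 1+-1≈0) (zeroˡ _) ⟩
      0#
    ∎
    where
    Y Y′ rest : Carrier
    Y = det R (suc n) (minor zero zero M)
    Y′ = det R (suc n) (minor (suc zero) zero M)
    rest = sumFin R n (λ i →
      sign (toℕ (suc (suc i))) * (M (suc (suc i)) zero * det R (suc n) (minor (suc (suc i)) zero M)))
    minors-agree : ∀ a b → minor (suc zero) zero M a b ≈ minor zero zero M a b
    minors-agree zero    b = row0≈row1 (suc b)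
    minors-agree (suc a) b = refl

  lower-cofactors-vanish zero    M row0≈row1 = refl
  lower-cofactors-vanish (suc n) M row0≈row1 = sumFin-zero (suc n) (λ i →
    cofactor-vanishes (sign (toℕ (suc (suc i)))) (M (suc (suc i)) zero)
      (det-equal-rows01≈0 n (minor (suc (suc i)) zero M) (λ j → row0≈row1 (suc j))))

  det-linear-row0 : ∀ n (M : Matrix (suc n)) (u v : Fin (suc n) → Carrier) a →
    (∀ j → M zero j ≈ u j - a * v j) →
    det R (suc n) M ≈ det R (suc n) (u ∷ tail M) - a * det R (suc n) (v ∷ tail M)
  det-linear-row0 n M u v a row0 =
    trans (sumFin-cong (suc n) term) (sumFin-linear (suc n) a (cofactor u) (cofactor v))
    where
    cofactor : (Fin (suc n) → Carrier) → Fin (suc n) → Carrier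
    cofactor w j = sign (toℕ j) * (w j * det R n (minor zero j M))
    split-term : ∀ s u v x → s * ((u - a * v) * x) ≈ s * (u * x) - a * (s * (v * x))
    split-term s u v x = begin
      s * ((u - a * v) * x)               ≈⟨ *-congˡ (*-congʳ (x-y≈x+-1*y u _)) ⟩
      s * ((u + -1# * (a * v)) * x)       ≈⟨ solve 6 (λ m s u a v x → s :* ((u :+ m :* (a :* v)) :* x)
                                                := s :* (u :* x) :+ m :* (a :* (s :* (v :* x)))) refl -1# s u a v x ⟩
      s * (u * x) + -1# * (a * (s * (v * x))) ≈⟨ x-y≈x+-1*y _ _ ⟨
      s * (u * x) - a * (s * (v * x))      ∎
    term : ∀ j → cofactor (M zero) j ≈ cofactor u j - a * cofactor v j
    term j = trans (*-congˡ {x = sign (toℕ j)} (*-congʳ (row0 j))) (split-term _ _ _ _)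

  det-subtract-row0-from-row1 : ∀ n a (M N : Matrix (suc (suc n))) →
    (∀ j → N zero j ≈ M zero j) →
    (∀ j → N (suc zero) j ≈ M (suc zero) j - a * M zero j) →
    (∀ i j → N (suc (suc i)) j ≈ M (suc (suc i)) j) →
    det R (suc (suc n)) N ≈ det R (suc (suc n)) M
  det-subtract-row0-from-row1 n a M N row0 row1 rows = begin
      det R (suc (suc n)) N
    ≈⟨ sumFin-cong (suc (suc n)) (λ j → *-congˡ {x = sign (toℕ j)} (*-cong (row0 j) (minor-linear j))) ⟩
      sumFin R (suc (suc n)) (λ j → sign (toℕ j) * (M zero j * (D M j - a * D M′ j)))
    ≈⟨ sumFin-cong (suc (suc n)) (λ j → split-term (sign (toℕ j)) (M zero j) (D M j) (D M′ j)) ⟩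
      sumFin R (suc (suc n)) (λ j → cofactor M j - a * cofactor M′ j)
    ≈⟨ sumFin-linear (suc (suc n)) a (cofactor M) (cofactor M′) ⟩
      det R (suc (suc n)) M - a * det R (suc (suc n)) M′
    ≈⟨ +-congˡ (-‿cong (trans (*-congˡ (det-equal-rows01≈0 n M′ (λ _ → refl))) (zeroʳ a))) ⟩
      det R (suc (suc n)) M - 0#
    ≈⟨ trans (+-congˡ -0#≈0#) (+-identityʳ _) ⟩
      det R (suc (suc n)) M
    ∎
    where
    M′ : Matrix (suc (suc n))
    M′ = M zero ∷ (M zero ∷ tail (tail M))
    D : Matrix (suc (suc n)) → Fin (suc (suc n)) → Carrier
    D L j = det R (suc n) (minor zero j L)
    cofactor : Matrix (suc (suc n)) → Fin (suc (suc n)) → Carrier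
    cofactor L j = sign (toℕ j) * (M zero j * D L j)
    minor-linear : ∀ j → D N j ≈ D M j - a * D M′ j
    minor-linear j =
      trans (det-linear-row0 n (minor zero j N) (minor zero j M zero) (minor zero j M′ zero) a
               (λ b → row1 (punchIn j b)))
            (+-cong (det-cong (suc n) rows-M) (-‿cong (*-congˡ (det-cong (suc n) rows-M′))))
      where
      rows-M : ∀ a b → (minor zero j M zero ∷ tail (minor zero j N)) a b ≈ minor zero j M a b
      rows-M zero    b = refl
      rows-M (suc a) b = rows a (punchIn j b)
      rows-M′ : ∀ a b → (minor zero j M′ zero ∷ tail (minor zero j N)) a b ≈ minor zero j M′ a b
      rows-M′ zero    b = refl
      rows-M′ (suc a) b = rows a (punchIn j b)
    split-term : ∀ s u x y → s * (u * (x - a * y)) ≈ s * (u * x) - a * (s * (u * y))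
    split-term s u x y = begin
      s * (u * (x - a * y))                    ≈⟨ *-congˡ (*-congˡ (x-y≈x+-1*y x _)) ⟩
      s * (u * (x + -1# * (a * y)))            ≈⟨ solve 6 (λ m s u a x y → s :* (u :* (x :+ m :* (a :* y)))
                                                   := s :* (u :* x) :+ m :* (a :* (s :* (u :* y)))) refl -1# s u a x y ⟩
      s * (u * x) + -1# * (a * (s * (u * y)))  ≈⟨ x-y≈x+-1*y _ _ ⟨
      s * (u * x) - a * (s * (u * y))          ∎

  -- Reduce row 1 against row 0 first; the remaining reductions then happen inside every minor of row 0.
  det-subtract-previous-rows : ∀ n (a : Fin n → Carrier) (M N : Matrix (suc n)) →
    (∀ j → N zero j ≈ M zero j) →
    (∀ i j → N (suc i) j ≈ M (suc i) j - a i * M (inject₁ i) j) →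
    det R (suc n) N ≈ det R (suc n) M
  det-subtract-previous-rows zero    a M N row0 rows = det-cong 1 {N} {M} (λ { zero j → row0 j })
  det-subtract-previous-rows (suc n) a M N row0 rows =
    trans (det-subtract-row0-from-row1 n (a zero) K N row0 (rows zero) (λ _ _ → refl))
          (sumFin-cong (suc (suc n)) (λ j → *-congˡ {x = sign (toℕ j)} (*-congˡ {x = M zero j}
            (det-subtract-previous-rows n (λ i → a (suc i)) (minor zero j M) (minor zero j K) (λ _ → refl)
              (λ i b → rows (suc i) (punchIn j b))))))
    where
    K : Matrix (suc (suc n))
    K zero          = M zero
    K (suc zero)    = M (suc zero)
    K (suc (suc i)) = N (suc (suc i))

  det-scale-rows : ∀ n (a : Fin n → Carrier) (M : Matrix n) →
                   det R n (λ i j → a i * M i j) ≈ prodFin R n a * det R n M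
  det-scale-rows zero    a M = sym (*-identityʳ 1#)
  det-scale-rows (suc n) a M =
    trans (sumFin-cong (suc n) term) (sym (*-distribˡ-sumFin (suc n) (prodFin R (suc n) a) cofactor))
    where
    cofactor : Fin (suc n) → Carrier
    cofactor j = sign (toℕ j) * (M zero j * det R n (minor zero j M))
    term : ∀ j → sign (toℕ j) * ((a zero * M zero j) * det R n (λ i b → a (suc i) * minor zero j M i b)) ≈
                 prodFin R (suc n) a * cofactor j
    term j = trans (*-congˡ {x = sign (toℕ j)} (*-congˡ {x = a zero * M zero j}
                     (det-scale-rows n (λ i → a (suc i)) (minor zero j M))))
      (solve 5 (λ s a u p x → s :* ((a :* u) :* (p :* x)) := (a :* p) :* (s :* (u :* x))) refl
        (sign (toℕ j)) (a zero) (M zero j) (prodFin R n (λ i → a (suc i))) (det R n (minor zero j M)))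

  det-scale-cols : ∀ n (b : Fin n → Carrier) (M : Matrix n) →
                   det R n (λ i j → M i j * b j) ≈ prodFin R n b * det R n M
  det-scale-cols zero    b M = sym (*-identityʳ 1#)
  det-scale-cols (suc n) b M = begin
      det R (suc n) (λ i j → M i j * b j)
    ≈⟨ det-expand-col0 n (λ i j → M i j * b j) ⟩
      sumFin R (suc n) (λ i →
        sign (toℕ i) * ((M i zero * b zero) * det R n (λ a j → minor i zero M a j * b (suc j))))
    ≈⟨ sumFin-cong (suc n) term ⟩
      sumFin R (suc n) (λ i → prodFin R (suc n) b * cofactor i)
    ≈⟨ *-distribˡ-sumFin (suc n) (prodFin R (suc n) b) cofactor ⟨
      prodFin R (suc n) b * sumFin R (suc n) cofactor
    ≈⟨ *-congˡ (det-expand-col0 n M) ⟨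
      prodFin R (suc n) b * det R (suc n) M
    ∎
    where
    cofactor : Fin (suc n) → Carrier
    cofactor i = sign (toℕ i) * (M i zero * det R n (minor i zero M))
    term : ∀ i → sign (toℕ i) * ((M i zero * b zero) * det R n (λ a j → minor i zero M a j * b (suc j))) ≈
                 prodFin R (suc n) b * cofactor i
    term i = trans (*-congˡ {x = sign (toℕ i)} (*-congˡ {x = M i zero * b zero}
                     (det-scale-cols n (λ j → b (suc j)) (minor i zero M))))
      (solve 5 (λ s u b p x → s :* ((u :* b) :* (p :* x)) := (b :* p) :* (s :* (u :* x))) refl
        (sign (toℕ i)) (M i zero) (b zero) (prodFin R n (λ j → b (suc j))) (det R n (minor i zero M)))

  det-unit-col0 : ∀ n (M : Matrix (suc n)) → M zero zero ≈ 1# → (∀ i → M (suc i) zero ≈ 0#) →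
                  det R (suc n) M ≈ det R n (minor zero zero M)
  det-unit-col0 n M corner below = begin
      det R (suc n) M
    ≈⟨ det-expand-col0 n M ⟩
      1# * (M zero zero * det R n (minor zero zero M)) + rest
    ≈⟨ +-cong (*-identityˡ _) (sumFin-zero n (λ i →
         trans (*-congˡ (trans (*-congʳ (below i)) (zeroˡ _))) (zeroʳ _))) ⟩
      M zero zero * det R n (minor zero zero M) + 0#
    ≈⟨ trans (+-identityʳ _) (trans (*-congʳ corner) (*-identityˡ _)) ⟩
      det R n (minor zero zero M)
    ∎
    where
    rest : Carrier
    rest = sumFin R n (λ i → sign (toℕ (suc i)) * (M (suc i) zero * det R n (minor (suc i) zero M)))

  hankel : ℕ → (ℕ → Carrier) → Carrier
  hankel n a = det R n (λ i j → a (toℕ i ℕ.+ toℕ j))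

  hankel-scale : ∀ n s {a b : ℕ → Carrier} → (∀ k → a k ≈ s * b k) →
                 hankel n a ≈ pow R s n * hankel n b
  hankel-scale n s a≈sb = trans (det-cong n (λ i j → a≈sb (toℕ i ℕ.+ toℕ j)))
    (trans (det-scale-rows n (λ _ → s) _) (*-congʳ (prodN-const n s)))

  module _ (q : Carrier) where

    poch⁺ : Carrier → ℕ → Carrier
    poch⁺ x k = poch R x q (suc k)

    poch-cong : ∀ x {k l} → k ≡.≡ l → poch R x q k ≈ poch R x q l
    poch-cong x k≡l = reflexive (≡.cong (poch R x q) k≡l)

    poch-suc : ∀ x k → poch R x q (suc k) ≈ poch R x q k * (1# - pow R q k * x)
    poch-suc x k = prodN-suc k (λ j → 1# - pow R q j * x)

    poch-shift : ∀ x k → poch R x q (suc k) ≈ (1# - x) * poch R (q * x) q k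
    poch-shift x k = *-cong (+-congˡ (-‿cong (*-identityˡ x))) (prodN-cong k (λ j →
      +-congˡ (-‿cong (solve 3 (λ q p x → (q :* p) :* x := p :* (q :* x)) refl q (pow R q j) x))))

    poch-row-difference : ∀ x i m →
      poch R x q (suc (i ℕ.+ m)) - (1# - pow R q i * x) * poch R x q (i ℕ.+ m) ≈
      (x * pow R q i) * (poch R x q (i ℕ.+ m) * (1# - pow R q m))
    poch-row-difference x i m = begin
        poch R x q (suc (i ℕ.+ m)) - (1# - P * x) * A
      ≈⟨ +-congʳ (trans (poch-suc x (i ℕ.+ m)) (*-congˡ (+-congˡ (-‿cong (*-congʳ (pow-homo-* q i m)))))) ⟩
        A * (1# - (P * Q) * x) - (1# - P * x) * A
      ≈⟨ trans (+-cong (*-congˡ (x-y≈x+-1*y _ _)) (-‿cong (*-congʳ (x-y≈x+-1*y _ _)))) (x-y≈x+-1*y _ _) ⟩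
        A * (1# + -1# * ((P * Q) * x)) + -1# * ((1# + -1# * (P * x)) * A)
      ≈⟨ solve 5 (λ A P Q x m → A :* (con 1 :+ m :* ((P :* Q) :* x)) :+ m :* ((con 1 :+ m :* (P :* x)) :* A)
                  := (con 1 :+ m) :* A :+ ((m :* m) :* ((x :* P) :* (A :* con 1)) :+ (x :* P) :* (A :* (m :* Q))))
           refl A P Q x -1# ⟩
        (1# + -1#) * A + ((-1# * -1#) * ((x * P) * (A * 1#)) + (x * P) * (A * (-1# * Q)))
      ≈⟨ +-cong (trans (*-congʳ 1+-1≈0) (zeroˡ A)) (+-congʳ (trans (*-congʳ -1*-1≈1) (*-identityˡ _))) ⟩
        0# + ((x * P) * (A * 1#) + (x * P) * (A * (-1# * Q)))
      ≈⟨ trans (+-identityˡ _) (trans (sym (distribˡ (x * P) _ _)) (*-congˡ (sym (distribˡ A _ _)))) ⟩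
        (x * P) * (A * (1# + -1# * Q))
      ≈⟨ *-congˡ (*-congˡ (x-y≈x+-1*y 1# Q)) ⟨
        (x * P) * (A * (1# - Q))
      ∎
      where
      A P Q : Carrier
      A = poch R x q (i ℕ.+ m)
      P = pow R q i
      Q = pow R q m

    qint-telescopes : ∀ k → (1# - q) * qint R q k ≈ 1# - pow R q k
    qint-telescopes zero    = trans (zeroʳ _) (sym (-‿inverseʳ 1#))
    qint-telescopes (suc k) = begin
        (1# - q) * (1# + sumFin R k (λ i → q * pow R q (toℕ i)))
      ≈⟨ *-congˡ (+-congˡ (sym (*-distribˡ-sumFin k q _))) ⟩
        (1# - q) * (1# + q * qint R q k)
      ≈⟨ solve 3 (λ w q s → w :* (con 1 :+ q :* s) := w :+ q :* (w :* s)) refl (1# - q) q (qint R q k) ⟩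
        (1# - q) + q * ((1# - q) * qint R q k)
      ≈⟨ +-congˡ (*-congˡ (qint-telescopes k)) ⟩
        (1# - q) + q * (1# - pow R q k)
      ≈⟨ +-cong (x-y≈x+-1*y 1# q) (*-congˡ (x-y≈x+-1*y 1# _)) ⟩
        (1# + -1# * q) + q * (1# + -1# * pow R q k)
      ≈⟨ solve 3 (λ m q p → (con 1 :+ m :* q) :+ q :* (con 1 :+ m :* p)
                            := (con 1 :+ m :* (q :* p)) :+ (con 1 :+ m) :* q) refl -1# q (pow R q k) ⟩
        (1# + -1# * (q * pow R q k)) + (1# + -1#) * q
      ≈⟨ trans (+-congˡ (trans (*-congʳ 1+-1≈0) (zeroˡ q))) (+-identityʳ _) ⟩
        1# + -1# * pow R q (suc k)
      ≈⟨ x-y≈x+-1*y 1# _ ⟨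
        1# - pow R q (suc k)
      ∎

    prodN-geometric : ∀ n x → prodN R n (λ i → x * pow R q i) ≈ pow R x n * pow R q (n C 2)
    prodN-geometric zero    x = sym (*-identityˡ 1#)
    prodN-geometric (suc n) x = begin
        (x * 1#) * prodN R n (λ i → x * (q * pow R q i))
      ≈⟨ *-congˡ (prodN-cong n (λ i →
           solve 3 (λ x q p → x :* (q :* p) := q :* (x :* p)) refl x q (pow R q i))) ⟩
        (x * 1#) * prodN R n (λ i → q * (x * pow R q i))
      ≈⟨ *-congˡ (trans (prodN-scale n q (λ i → x * pow R q i)) (*-congˡ (prodN-geometric n x))) ⟩
        (x * 1#) * (pow R q n * (pow R x n * pow R q (n C 2)))
      ≈⟨ solve 4 (λ x a b c → (x :* con 1) :* (a :* (b :* c)) := (x :* b) :* (a :* c))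
           refl x (pow R q n) (pow R x n) (pow R q (n C 2)) ⟩
        pow R x (suc n) * (pow R q n * pow R q (n C 2))
      ≈⟨ *-congˡ (pow-split q n (n C 2) ([1+n]C2≡n+nC2 n)) ⟨
        pow R x (suc n) * pow R q (suc n C 2)
      ∎

    prodN-1-q^suc : ∀ n → prodN R n (λ j → 1# - pow R q (suc j)) ≈ pow R (1# - q) n * qfact R q n
    prodN-1-q^suc n = trans (prodN-cong n (λ j → sym (qint-telescopes (suc j))))
                            (prodN-scale n (1# - q) (λ j → qint R q (suc j)))

    prodN-qfact-suc : ∀ n (f : ℕ → Carrier) →
                      prodN R n (λ j → qfact R q (suc j) * f j) ≈ qfact R q n * prodN R n (λ j → qfact R q j * f j)
    prodN-qfact-suc n f = trans
      (prodN-cong n (λ j → trans (*-congʳ (prodN-suc j (λ i → qint R q (suc i))))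
        (solve 3 (λ a i b → (a :* i) :* b := i :* (a :* b)) refl (qfact R q j) (qint R q (suc j)) (f j))))
      (prodN-distrib-* n (λ j → qint R q (suc j)) (λ j → qfact R q j * f j))

    prodN-qfact-poch-shift : ∀ n x → prodN R n (λ j → qfact R q j * poch⁺ x j) ≈
                                      pow R (1# - x) n * prodN R n (λ j → qfact R q j * poch R (q * x) q j)
    prodN-qfact-poch-shift n x = trans
      (prodN-cong n (λ j → trans (*-congˡ (poch-shift x j))
        (solve 3 (λ f v p → f :* (v :* p) := v :* (f :* p)) refl (qfact R q j) (1# - x) (poch R (q * x) q j))))
      (prodN-scale n (1# - x) (λ j → qfact R q j * poch R (q * x) q j))

    eliminationFactor : ℕ → Carrier → Carrier
    eliminationFactor n x = (pow R x n * pow R q (n C 2)) * (pow R (1# - q) n * qfact R q n)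

    hankel-poch-suc : ∀ n x → hankel (suc n) (poch R x q) ≈ eliminationFactor n x * hankel n (poch⁺ x)
    hankel-poch-suc n x = begin
        hankel (suc n) (poch R x q)
      ≈⟨ det-subtract-previous-rows n (λ i → 1# - pow R q (toℕ i) * x) M N (λ _ → refl) reduced-rows ⟨
        det R (suc n) N
      ≈⟨ det-unit-col0 n N refl first-column-vanishes ⟩
        det R n (λ i j → row-factor i * (E i j * col-factor j))
      ≈⟨ det-scale-rows n row-factor _ ⟩
        prodFin R n row-factor * det R n (λ i j → E i j * col-factor j)
      ≈⟨ *-congˡ (det-scale-cols n col-factor E) ⟩
        prodFin R n row-factor * (prodFin R n col-factor * det R n E)
      ≈⟨ *-cong (prodN-geometric n x)
                (*-cong (prodN-1-q^suc n) (det-cong n (λ i j → poch-cong x (ℕₚ.+-suc (toℕ i) (toℕ j))))) ⟩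
        (pow R x n * pow R q (n C 2)) * ((pow R (1# - q) n * qfact R q n) * hankel n (poch⁺ x))
      ≈⟨ *-assoc _ _ _ ⟨
        eliminationFactor n x * hankel n (poch⁺ x)
      ∎
      where
      row-factor col-factor : Fin n → Carrier
      row-factor i = x * pow R q (toℕ i)
      col-factor j = 1# - pow R q (suc (toℕ j))
      E : Matrix n
      E i j = poch R x q (toℕ i ℕ.+ suc (toℕ j))
      M N : Matrix (suc n)
      M i j = poch R x q (toℕ i ℕ.+ toℕ j)
      N zero    j = M zero j
      N (suc i) j = row-factor i * (poch R x q (toℕ i ℕ.+ toℕ j) * (1# - pow R q (toℕ j)))
      reduced-rows : ∀ i j → N (suc i) j ≈ M (suc i) j - (1# - pow R q (toℕ i) * x) * M (inject₁ i) j
      reduced-rows i j = sym (trans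
        (+-congˡ (-‿cong (*-congˡ (poch-cong x (≡.cong (ℕ._+ toℕ j) (toℕ-inject₁ i))))))
        (poch-row-difference x (toℕ i) (toℕ j)))
      first-column-vanishes : ∀ i → N (suc i) zero ≈ 0#
      first-column-vanishes i = trans (*-congˡ (trans (*-congˡ (-‿inverseʳ 1#)) (zeroʳ _))) (zeroʳ _)

    hankel-poch⁺ : ∀ n x → hankel n (poch⁺ x) ≈ pow R (1# - x) n * hankel n (poch R (q * x) q)
    hankel-poch⁺ n x = hankel-scale n (1# - x) (poch-shift x)

    value₀ value₁ : ℕ → Carrier → Carrier
    value₀ n x = pow R q (2 ℕ.* (n C 3)) *
                 (pow R (1# - q) (n C 2) * (pow R x (n C 2) * prodN R n (λ j → qfact R q j * poch R x q j)))
    value₁ n x = pow R q (2 ℕ.* (n C 3) ℕ.+ n C 2) *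
                 (pow R (1# - q) (n C 2) * (pow R x (n C 2) * prodN R n (λ j → qfact R q j * poch⁺ x j)))

    value₀-suc : ∀ n x → value₀ (suc n) x ≈ eliminationFactor n x * value₁ n x
    value₀-suc n x = begin
        value₀ (suc n) x
      ≈⟨ *-cong (pow-split q (n C 2) _ (2*[1+n]C3≡nC2+[2*nC3+nC2] n))
           (*-cong (pow-split (1# - q) n (n C 2) ([1+n]C2≡n+nC2 n))
             (*-cong (pow-split x n (n C 2) ([1+n]C2≡n+nC2 n)) (*-congˡ (prodN-qfact-suc n (poch⁺ x))))) ⟩
        (Q2 * Q′) * ((Wn * W2) * ((Xn * X2) * ((1# * 1#) * (F * P))))
      ≈⟨ solve 8 (λ Q2 Q′ Wn W2 Xn X2 F P →
                    (Q2 :* Q′) :* ((Wn :* W2) :* ((Xn :* X2) :* ((con 1 :* con 1) :* (F :* P))))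
                    := ((Xn :* Q2) :* (Wn :* F)) :* (Q′ :* (W2 :* (X2 :* P))))
           refl Q2 Q′ Wn W2 Xn X2 F P ⟩
        eliminationFactor n x * value₁ n x
      ∎
      where
      Q2 Q′ Wn W2 Xn X2 F P : Carrier
      Q2 = pow R q (n C 2)
      Q′ = pow R q (2 ℕ.* (n C 3) ℕ.+ n C 2)
      Wn = pow R (1# - q) n
      W2 = pow R (1# - q) (n C 2)
      Xn = pow R x n
      X2 = pow R x (n C 2)
      F = qfact R q n
      P = prodN R n (λ j → qfact R q j * poch⁺ x j)

    value₁-shift : ∀ n x → value₁ n x ≈ pow R (1# - x) n * value₀ n (q * x)
    value₁-shift n x = begin
        value₁ n x
      ≈⟨ *-cong (pow-homo-* q (2 ℕ.* (n C 3)) (n C 2)) (*-congˡ (*-congˡ (prodN-qfact-poch-shift n x))) ⟩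
        (Q3 * Q2) * (W2 * (X2 * (Vn * P)))
      ≈⟨ solve 6 (λ Q3 Q2 W2 X2 Vn P → (Q3 :* Q2) :* (W2 :* (X2 :* (Vn :* P)))
                   := Vn :* (Q3 :* (W2 :* ((Q2 :* X2) :* P)))) refl Q3 Q2 W2 X2 Vn P ⟩
        Vn * (Q3 * (W2 * ((Q2 * X2) * P)))
      ≈⟨ *-congˡ (*-congˡ (*-congˡ (*-congʳ (pow-distrib-* q x (n C 2))))) ⟨
        pow R (1# - x) n * value₀ n (q * x)
      ∎
      where
      Q3 Q2 W2 X2 Vn P : Carrier
      Q3 = pow R q (2 ℕ.* (n C 3))
      Q2 = pow R q (n C 2)
      W2 = pow R (1# - q) (n C 2)
      X2 = pow R x (n C 2)
      Vn = pow R (1# - x) n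
      P = prodN R n (λ j → qfact R q j * poch R (q * x) q j)

    hankel₀≈value₀ : ∀ n x → hankel n (poch R x q) ≈ value₀ n x
    hankel₁≈value₁ : ∀ n x → hankel n (poch⁺ x) ≈ value₁ n x

    hankel₀≈value₀ zero    x = sym (trans (*-identityˡ _) (trans (*-identityˡ _) (*-identityˡ _)))
    hankel₀≈value₀ (suc n) x = begin
      hankel (suc n) (poch R x q)                 ≈⟨ hankel-poch-suc n x ⟩
      eliminationFactor n x * hankel n (poch⁺ x)  ≈⟨ *-congˡ (hankel₁≈value₁ n x) ⟩
      eliminationFactor n x * value₁ n x          ≈⟨ value₀-suc n x ⟨
      value₀ (suc n) x                            ∎

    hankel₁≈value₁ n x = begin
      hankel n (poch⁺ x)                             ≈⟨ hankel-poch⁺ n x ⟩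
      pow R (1# - x) n * hankel n (poch R (q * x) q) ≈⟨ *-congˡ (hankel₀≈value₀ n (q * x)) ⟩
      pow R (1# - x) n * value₀ n (q * x)            ≈⟨ value₁-shift n x ⟨
      value₁ n x                                     ∎

open import Data.Nat using (_+_; _*_; _≤_)

lemma4 : ∀ {c ℓ} (R : CommutativeRing c ℓ) (q x : CommutativeRing.Carrier R) (n : ℕ) → 1 ≤ n →
           (CommutativeRing._≈_ R
             (det R n (λ i j → poch R x q (toℕ i + toℕ j)))
             (CommutativeRing._*_ R (pow R q (2 * (n C 3)))
               (CommutativeRing._*_ R (pow R (CommutativeRing._-_ R (CommutativeRing.1# R) q) (n C 2))
                 (CommutativeRing._*_ R (pow R x (n C 2))
                   (prodN R n (λ j → CommutativeRing._*_ R (qfact R q j) (poch R x q j)))))))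
           ×
           (CommutativeRing._≈_ R
             (det R n (λ i j → poch R x q (suc (toℕ i + toℕ j))))
             (CommutativeRing._*_ R (pow R q (2 * (n C 3) + n C 2))
               (CommutativeRing._*_ R (pow R (CommutativeRing._-_ R (CommutativeRing.1# R) q) (n C 2))
                 (CommutativeRing._*_ R (pow R x (n C 2))
                   (prodN R n (λ j → CommutativeRing._*_ R (qfact R q j) (poch R x q (suc j))))))))
lemma4 R q x n _ = hankel₀≈value₀ R q n x , hankel₁≈value₁ R q n x
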